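{- Let $k>1$ be an integer and $\sigma$ a permutation of $\{0,1,\ldots,n\}$. Any perfect $(\sigma,k)$-permutiple $[a_0;a_1,\ldots,a_n]$ has an even number of digits (i.e. $n+1$ is even), and every perfect permutiple is continuant-preserving.
   Context: For positive integers $a_0,\ldots,a_n$, $[a_0;a_1,\ldots,a_n]$ denotes the finite simple continued fraction $a_0+1/(a_1+1/(\cdots+1/a_n))$; all finite continued fractions are assumed in canonical form (last digit at least $2$ when there are at least two digits). For an integer $k>1$ and a permutation $\sigma$ of $\{0,\ldots,n\}$, $r=[a_0;\ldots,a_n]$ is a $(\sigma,k)$-permutiple if $r=k\,[a_{\sigma(0)};a_{\sigma(1)},\ldots,a_{\sigma(n)}]$. It is perfect if $a_j=k\,a_{\sigma(j)}$ for every even $j$ and $a_{\sigma(j)}=k\,a_j$ for every odd $j$ ($0\le j\le n$). Continuants: $K_0()=1$, $K_1(x_0)=x_0$, $K_m(x_0,\ldots,x_{m-1})=x_{m-1}K_{m-1}(x_0,\ldots,x_{m-2})+K_{m-2}(x_0,\ldots,x_{m-3})$. The permutiple is continuant-preserving if $K_{n+1}(a_0,\ldots,a_n)=K_{n+1}(a_{\sigma(0)},\ldots,a_{\sigma(n)})$. -}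

module Defs where

open import Data.Nat as ℕ using (ℕ; zero; suc; _*_; _+_)
open import Data.Fin using (Fin; zero; suc; fromℕ; inject₁)
open import Data.Rational as ℚ using (ℚ; 0ℚ)
import Data.Rational.Properties as ℚP
open import Relation.Nullary using (yes; no)
open import Function using (_∘_)
open import Data.Integer using (+_)

ℕ→ℚ : ℕ → ℚ
ℕ→ℚ x = (+ x) ℚ./ 1

-- Total reciprocal on ℚ (junk value 0 at 0; never used at 0 for positive digits).
inv : ℚ → ℚ
inv q with q ℚP.≟ 0ℚ
... | yes _ = 0ℚ
... | no q≢0 = ℚ.1/_ q {{ℚ.≢-nonZero q≢0}}

cf : (n : ℕ) → (Fin (suc n) → ℕ) → ℚ
cf zero    a = ℕ→ℚ (a zero)
cf (suc n) a = ℕ→ℚ (a zero) ℚ.+ inv (cf n (a ∘ suc))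

K : (m : ℕ) → (Fin m → ℕ) → ℕ
K zero          x = 1
K (suc zero)    x = x zero
K (suc (suc m)) x = x (fromℕ (suc m)) * K (suc m) (x ∘ inject₁)
                    + K m (x ∘ inject₁ ∘ inject₁)

module Submission where

-- A perfect (σ,k)-permutiple [a₀;…,aₙ] is governed by a purely local relation
-- between the digit string x = a and its rearrangement y = a ∘ σ:
--   xⱼ = k·yⱼ at even positions j,   yⱼ = k·xⱼ at odd positions j.
-- We call such a pair (x, y) k-perfect and prove two facts about k-perfect
-- pairs of any length N, each by induction on N in steps of two:
--   * digit products: ∏x = ∏y if N is even, ∏x = k·∏y if N is odd
--     (strip the first two digits, whose contributions cancel);
--   * continuants:    K(x) = K(y) if N is even, K(x) = k·K(y) if N is odd
--     (use the recurrence of K in its last entry).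
-- "N is odd" is expressed as 2 ∣ N + 1, which keeps the induction positive.
-- For the theorem, y = a ∘ σ is a permutation of x = a, so ∏x = ∏y; an odd
-- number of digits would force ∏a = k·∏a with ∏a ≥ 1 and k > 1, which is
-- impossible.  Hence n + 1 is even and the continuant result applies.

open import Defs
open import Data.Nat using (ℕ; zero; suc; _*_; _+_; _<_; _≤_; s≤s; z≤n)
open import Data.Nat.Properties
  using (*-1-commutativeMonoid; *-mono-≤; *-comm; *-assoc; m<m*n; <⇒≢)
open import Data.Nat.Divisibility using (_∣_; _∣0; ∣-refl; ∣⇒≤; ∣m+n∣m⇒∣n; ∣m∣n⇒∣m+n)
open import Data.Fin using (Fin; toℕ; fromℕ; inject₁)
open import Data.Fin.Properties using (toℕ-fromℕ; toℕ-inject₁)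
open import Data.Fin.Permutation using (Permutation′; _⟨$⟩ʳ_)
open import Data.Rational using () renaming (_*_ to _*ℚ_)
open import Data.Product using (_×_; _,_; proj₁; proj₂)
open import Data.Sum using (_⊎_; inj₁; inj₂)
open import Data.Empty using (⊥-elim)
open import Function using (_∘_)
open import Relation.Nullary using (¬_)
open import Relation.Binary.PropositionalEquality
open import Data.Nat.Solver using (module +-*-Solver)
open +-*-Solver using (solve; _:*_; _:+_; _:=_)
open import Algebra.Properties.CommutativeMonoid.Sum *-1-commutativeMonoid
  using () renaming (sum to product; sum-permute to product-permute)

2∣-suc-suc : ∀ {n} → 2 ∣ n → 2 ∣ suc (suc n)
2∣-suc-suc = ∣m∣n⇒∣m+n ∣-refl

2∣-pred-pred : ∀ {n} → 2 ∣ suc (suc n) → 2 ∣ n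
2∣-pred-pred 2∣n+2 = ∣m+n∣m⇒∣n 2∣n+2 ∣-refl

¬2∣1 : ¬ (2 ∣ 1)
¬2∣1 2∣1 with ∣⇒≤ 2∣1
... | s≤s ()

¬2∣-suc : ∀ {n} → 2 ∣ n → ¬ (2 ∣ suc n)
¬2∣-suc {zero}        _    = ¬2∣1
¬2∣-suc {suc zero}    2∣1  = ⊥-elim (¬2∣1 2∣1)
¬2∣-suc {suc (suc n)} 2∣n+2 = ¬2∣-suc (2∣-pred-pred 2∣n+2) ∘ 2∣-pred-pred

even-or-odd : ∀ n → 2 ∣ n ⊎ 2 ∣ suc n
even-or-odd zero    = inj₁ (2 ∣0)
even-or-odd (suc n) with even-or-odd n
... | inj₁ 2∣n   = inj₂ (2∣-suc-suc 2∣n)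
... | inj₂ 2∣n+1 = inj₁ 2∣n+1

no-fixpoint : ∀ {k p} → 1 < k → 1 ≤ p → p ≢ k * p
no-fixpoint {k} {suc q} k>1 _ p≡kp = <⇒≢ (m<m*n (suc q) k k>1) (trans p≡kp (*-comm k (suc q)))

product-positive : ∀ {N} (x : Fin N → ℕ) → (∀ j → 1 ≤ x j) → 1 ≤ product x
product-positive {zero}  x pos = s≤s z≤n
product-positive {suc N} x pos = *-mono-≤ (pos Fin.zero) (product-positive (x ∘ Fin.suc) (pos ∘ Fin.suc))

Perfect : ℕ → (N : ℕ) → (Fin N → ℕ) → (Fin N → ℕ) → Set
Perfect k N x y =
  ∀ j → (2 ∣ toℕ j → x j ≡ k * y j) × (¬ (2 ∣ toℕ j) → y j ≡ k * x j)

module _ (k : ℕ) where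

  perfect-drop₂ : ∀ {N x y} → Perfect k (suc (suc N)) x y →
                  Perfect k N (x ∘ Fin.suc ∘ Fin.suc) (y ∘ Fin.suc ∘ Fin.suc)
  perfect-drop₂ perf j =
    (λ 2∣j → proj₁ (perf (Fin.suc (Fin.suc j))) (2∣-suc-suc 2∣j)) ,
    (λ 2∤j → proj₂ (perf (Fin.suc (Fin.suc j))) (2∤j ∘ 2∣-pred-pred))

  perfect-init : ∀ {N x y} → Perfect k (suc N) x y →
                 Perfect k N (x ∘ inject₁) (y ∘ inject₁)
  perfect-init perf j rewrite sym (toℕ-inject₁ j) = perf (inject₁ j)

  -- Digit products of a perfect pair: each even position contributes a factor k
  -- to ∏x, each odd position a factor k to ∏y.
  perfect-product : ∀ N {x y} → Perfect k N x y →
    (2 ∣ N → product x ≡ product y) × (2 ∣ suc N → product x ≡ k * product y)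
  perfect-product zero          perf = (λ _ → refl) , (λ 2∣1 → ⊥-elim (¬2∣1 2∣1))
  perfect-product (suc zero)    perf =
    (λ 2∣1 → ⊥-elim (¬2∣1 2∣1)) ,
    (λ _ → trans (cong (_* 1) (proj₁ (perf Fin.zero) (2 ∣0))) (*-assoc k _ 1))
  perfect-product (suc (suc N)) {x} {y} perf
    rewrite proj₁ (perf Fin.zero) (2 ∣0) | proj₂ (perf (Fin.suc Fin.zero)) ¬2∣1 =
      (λ 2∣N+2 → begin
        k * y₀ * (x₁ * ∏x)         ≡⟨ cong (λ p → k * y₀ * (x₁ * p)) (proj₁ rest (2∣-pred-pred 2∣N+2)) ⟩
        k * y₀ * (x₁ * ∏y)         ≡⟨ solve 4 (λ k a b r → (k :* a) :* (b :* r) := a :* ((k :* b) :* r)) refl k y₀ x₁ ∏y ⟩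
        y₀ * (k * x₁ * ∏y)         ∎) ,
      (λ 2∣N+3 → begin
        k * y₀ * (x₁ * ∏x)         ≡⟨ cong (λ p → k * y₀ * (x₁ * p)) (proj₂ rest (2∣-pred-pred 2∣N+3)) ⟩
        k * y₀ * (x₁ * (k * ∏y))   ≡⟨ solve 4 (λ k a b r → (k :* a) :* (b :* (k :* r)) := k :* (a :* ((k :* b) :* r))) refl k y₀ x₁ ∏y ⟩
        k * (y₀ * (k * x₁ * ∏y))   ∎)
    where
      open ≡-Reasoning
      y₀ = y Fin.zero
      x₁ = x (Fin.suc Fin.zero)
      ∏x = product (x ∘ Fin.suc ∘ Fin.suc)
      ∏y = product (y ∘ Fin.suc ∘ Fin.suc)
      rest = perfect-product N (perfect-drop₂ perf)

  ContinuantRelation : (N : ℕ) → (Fin N → ℕ) → (Fin N → ℕ) → Set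
  ContinuantRelation N x y = (2 ∣ N → K N x ≡ K N y) × (2 ∣ suc N → K N x ≡ k * K N y)

  -- Inductive step, via K(x₀…x_{N+1}) = x_{N+1}·K(x₀…x_N) + K(x₀…x_{N-1}):
  -- the last digits are related by the factor k on the side given by the parity
  -- of N + 1, and the two shorter continuants by the relation for N + 1 and N.
  continuant-step : ∀ N {x y} → Perfect k (suc (suc N)) x y →
    ContinuantRelation (suc N) (x ∘ inject₁) (y ∘ inject₁) →
    ContinuantRelation N (x ∘ inject₁ ∘ inject₁) (y ∘ inject₁ ∘ inject₁) →
    ContinuantRelation (suc (suc N)) x y
  continuant-step N {x} {y} perf IH₁ IH₂ = even-case , odd-case
    where
      open ≡-Reasoning
      last = fromℕ (suc N)
      xₗ = x last
      yₗ = y last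
      K₁x = K (suc N) (x ∘ inject₁)
      K₁y = K (suc N) (y ∘ inject₁)
      K₂x = K N (x ∘ inject₁ ∘ inject₁)
      K₂y = K N (y ∘ inject₁ ∘ inject₁)

      even-case : 2 ∣ suc (suc N) → xₗ * K₁x + K₂x ≡ yₗ * K₁y + K₂y
      even-case 2∣N+2 = begin
        xₗ * K₁x + K₂x         ≡⟨ cong₂ (λ p q → xₗ * p + q) (proj₂ IH₁ 2∣N+2) (proj₁ IH₂ 2∣N) ⟩
        xₗ * (k * K₁y) + K₂y   ≡⟨ cong (_+ K₂y) (solve 3 (λ a k b → a :* (k :* b) := (k :* a) :* b) refl xₗ k K₁y) ⟩
        k * xₗ * K₁y + K₂y     ≡⟨ cong (λ p → p * K₁y + K₂y) (sym yₗ≡kxₗ) ⟩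
        yₗ * K₁y + K₂y         ∎
        where
          2∣N = 2∣-pred-pred 2∣N+2
          yₗ≡kxₗ = proj₂ (perf last) (subst (λ i → ¬ (2 ∣ i)) (sym (toℕ-fromℕ (suc N))) (¬2∣-suc 2∣N))

      odd-case : 2 ∣ suc (suc (suc N)) → xₗ * K₁x + K₂x ≡ k * (yₗ * K₁y + K₂y)
      odd-case 2∣N+3 = begin
        xₗ * K₁x + K₂x             ≡⟨ cong₂ (λ p q → p * K₁x + q) xₗ≡kyₗ (proj₂ IH₂ 2∣N+1) ⟩
        k * yₗ * K₁x + k * K₂y     ≡⟨ cong (λ p → k * yₗ * p + k * K₂y) (proj₁ IH₁ 2∣N+1) ⟩
        k * yₗ * K₁y + k * K₂y     ≡⟨ solve 4 (λ k a b c → (k :* a) :* b :+ k :* c := k :* (a :* b :+ c)) refl k yₗ K₁y K₂y ⟩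
        k * (yₗ * K₁y + K₂y)       ∎
        where
          2∣N+1 = 2∣-pred-pred 2∣N+3
          xₗ≡kyₗ = proj₁ (perf last) (subst (2 ∣_) (sym (toℕ-fromℕ (suc N))) 2∣N+1)

  perfect-continuant : ∀ N {x y} → Perfect k N x y → ContinuantRelation N x y
  perfect-continuant zero          perf = (λ _ → refl) , (λ 2∣1 → ⊥-elim (¬2∣1 2∣1))
  perfect-continuant (suc zero)    perf =
    (λ 2∣1 → ⊥-elim (¬2∣1 2∣1)) , (λ _ → proj₁ (perf Fin.zero) (2 ∣0))
  perfect-continuant (suc (suc N)) perf =
    continuant-step N perf (perfect-continuant (suc N) (perfect-init perf))
                           (perfect-continuant N (perfect-init (perfect-init perf)))

corollary11 : (k n : ℕ) → 1 < k → (σ : Permutation′ (suc n)) → (a : Fin (suc n) → ℕ) →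
    (∀ j → 1 ≤ a j) → (1 ≤ n → 2 ≤ a (fromℕ n)) →
    cf n a ≡ ℕ→ℚ k *ℚ cf n (λ j → a (σ ⟨$⟩ʳ j)) →
    (∀ j → (2 ∣ toℕ j → a j ≡ k * a (σ ⟨$⟩ʳ j))
    × (¬ (2 ∣ toℕ j) → a (σ ⟨$⟩ʳ j) ≡ k * a j)) →
    (2 ∣ suc n) × (K (suc n) a ≡ K (suc n) (λ j → a (σ ⟨$⟩ʳ j)))
corollary11 k n k>1 σ a pos _ _ perfect = even-length , proj₁ (perfect-continuant k (suc n) perfect) even-length
  where
    same-product : product a ≡ product (λ j → a (σ ⟨$⟩ʳ j))
    same-product = product-permute a σ

    even-length : 2 ∣ suc n
    even-length with even-or-odd (suc n)
    ... | inj₁ 2∣n+1 = 2∣n+1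
    ... | inj₂ 2∣n+2 = ⊥-elim (no-fixpoint k>1 (product-positive a pos)
            (trans (proj₂ (perfect-product k (suc n) perfect) 2∣n+2) (cong (k *_) (sym same-product))))
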